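{- The scheme $[\langle A\setminus(G\cup H)\rangle]\varphi\to\langle[G]\rangle\langle[H]\rangle\varphi$ is not valid: there exist a finite set of agents $A$, subsets $G,H\subseteq A$ and a formula $\varphi\in\mathcal{L}_{CoRGAL}$ such that $[\langle A\setminus(G\cup H)\rangle]\varphi\to\langle[G]\rangle\langle[H]\rangle\varphi$ is false at some pointed epistemic model.
   Context: Given a finite set $A$ of agents and a countable set $P$ of propositional variables, the language $\mathcal{L}_{CoRGAL}$ is given by $\varphi ::= p \mid \neg\varphi \mid (\varphi\wedge\varphi) \mid K_a\varphi \mid [\varphi]\varphi \mid [G,\varphi]\varphi \mid [\langle G\rangle]\varphi$ with $p\in P$, $a\in A$, $G\subseteq A$; $\langle\varphi\rangle\psi:=\neg[\varphi]\neg\psi$, $\langle[G]\rangle\varphi:=\neg[\langle G\rangle]\neg\varphi$. $\mathcal{L}_{EL}$ is the fragment built only from $p,\neg,\wedge,K_a$. For $G\subseteq A$, $\mathcal{L}_{EL}^G$ is the set of formulas $\bigwedge_{i\in G}K_i\varphi_i$ with each $\varphi_i\in\mathcal{L}_{EL}$; $\psi_G$ denotes an element of $\mathcal{L}_{EL}^G$, $\chi_{A\setminus G}$ one of $\mathcal{L}_{EL}^{A\setminus G}$. An epistemic model is $M=(W,\sim,V)$ with $W\neq\emptyset$, each $\sim_a$ an equivalence relation, $V:P\to\mathcal{P}(W)$. $M^\varphi$ is the restriction of $M$ to the states where $\varphi$ holds. Semantics: $p,\neg,\wedge$ as usual; $K_a\varphi$ true at $w$ iff $\varphi$ true at all $v\sim_a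 w$; $(M,w)\models[\varphi]\psi$ iff $(M,w)\models\varphi$ implies $(M^\varphi,w)\models\psi$; $(M,w)\models[G,\chi]\varphi$ iff $(M,w)\models\chi$ and for all $\psi_G$, $(M,w)\models[\psi_G\wedge\chi]\varphi$; $(M,w)\models[\langle G\rangle]\varphi$ iff for all $\psi_G$ there is $\chi_{A\setminus G}$ with $(M,w)\models\psi_G\to\langle\psi_G\wedge\chi_{A\setminus G}\rangle\varphi$. Equivalently, $(M,w)\models\langle[G]\rangle\varphi$ iff there is $\psi_G$ such that for all $\chi_{A\setminus G}$, $(M,w)\models\psi_G\wedge[\psi_G\wedge\chi_{A\setminus G}]\varphi$. Valid means true at every pointed model. -}

module Defs where

open import Data.Nat using (ℕ)
open import Data.Fin using (Fin)
open import Data.Fin.Subset using (Subset; _∈_; _∪_; ∁)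
open import Data.Product using (Σ; _×_; _,_; proj₁; proj₂)
open import Relation.Nullary using (¬_)
open import Relation.Binary.Structures using (IsEquivalence)

data EL (n : ℕ) : Set where
  varE : ℕ → EL n
  negE : EL n → EL n
  andE : EL n → EL n → EL n
  KE   : Fin n → EL n → EL n

data Form (n : ℕ) : Set where
  var  : ℕ → Form n
  neg  : Form n → Form n
  and  : Form n → Form n → Form n
  K    : Fin n → Form n → Form n
  ann  : Form n → Form n → Form n
  grp  : Subset n → Form n → Form n → Form n    -- [G,χ]φ
  coal : Subset n → Form n → Form n             -- [⟨G⟩]φ

imp : ∀ {n} → Form n → Form n → Form n
imp a b = neg (and a (neg b))

dia : ∀ {n} → Form n → Form n → Form n
dia a b = neg (ann a (neg b))

dcoal : ∀ {n} → Subset n → Form n → Form n      -- ⟨[G]⟩φ := ¬[⟨G⟩]¬φ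
dcoal G a = neg (coal G (neg a))

-- Epistemic models (W nonempty is automatic for pointed models)
record Model (n : ℕ) : Set₁ where
  field
    W     : Set
    R     : Fin n → W → W → Set
    R-eq  : (a : Fin n) → IsEquivalence (R a)
    V     : ℕ → W → Set

open Model public

restrict : ∀ {n} (M : Model n) → (W M → Set) → Model n
restrict M P = record
  { W    = Σ (W M) P
  ; R    = λ a u v → R M a (proj₁ u) (proj₁ v)
  ; R-eq = λ a → record
      { refl  = IsEquivalence.refl (R-eq M a)
      ; sym   = IsEquivalence.sym (R-eq M a)
      ; trans = IsEquivalence.trans (R-eq M a) }
  ; V    = λ p u → V M p (proj₁ u)
  }

satEL : ∀ {n} (M : Model n) → W M → EL n → Set
satEL M w (varE p)   = V M p w
satEL M w (negE φ)   = ¬ satEL M w φ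
satEL M w (andE φ ψ) = satEL M w φ × satEL M w ψ
satEL M w (KE a φ)   = ∀ v → R M a w v → satEL M v φ

-- A formula of L_EL^G, ⋀_{i∈G} K_i φ_i, is given by the family (φ_i)_i;
-- its truth at w:
conjK : ∀ {n} (M : Model n) → Subset n → (Fin n → EL n) → W M → Set
conjK M G ψ w = ∀ i → i ∈ G → satEL M w (KE i (ψ i))

sat : ∀ {n} (M : Model n) → W M → Form n → Set
sat M w (var p)   = V M p w
sat M w (neg φ)   = ¬ sat M w φ
sat M w (and φ ψ) = sat M w φ × sat M w ψ
sat M w (K a φ)   = ∀ v → R M a w v → sat M v φ
sat M w (ann φ ψ) =
  (h : sat M w φ) → sat (restrict M (λ v → sat M v φ)) (w , h) ψ
sat M w (grp G χ φ) =
  sat M w χ ×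
  ((ψ : Fin _ → EL _) →
     (h : conjK M G ψ w × sat M w χ) →
     sat (restrict M (λ v → conjK M G ψ v × sat M v χ)) (w , h) φ)
sat M w (coal G φ) =
  (ψ : Fin _ → EL _) → Σ (Fin _ → EL _) λ χ →
    conjK M G ψ w →
    ¬ ((h : conjK M G ψ w × conjK M (∁ G) χ w) →
         ¬ sat (restrict M (λ v → conjK M G ψ v × conjK M (∁ G) χ v)) (w , h) φ)

scheme : ∀ {n} → Subset n → Subset n → Form n → Form n
scheme G H φ = imp (coal (∁ (G ∪ H)) φ) (dcoal G (dcoal H φ))

module Submission where

-- Agents a and b; variables p (= var 0) and q (= var 1); the four worlds are
-- the valuations (p , q); agent a observes q only, agent b observes p only.
-- Take G = {a}, H = {b} (so A∖(G∪H) = ∅), φ = K_a p ∧ ¬K_b q, and w₀ = (true , true).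
--   * The antecedent holds: the grand coalition can announce K_b p (a stays
--     silent); afterwards a knows p, yet b still considers (true , false)
--     possible.
--   * The consequent fails because [⟨G⟩][⟨H⟩]¬φ holds: whatever a announces,
--     b stays silent; then whatever b announces, a answers with K_a q, after
--     which q holds everywhere, so b knows q and φ is false.

open import Defs
open import Data.Nat using (ℕ)
open import Data.Fin using (Fin; zero; suc)
open import Data.Fin.Subset using (Subset; _∈_; _∪_; ∁; ⊥; ⊤; ⁅_⁆)
open import Data.Fin.Subset.Properties using (∉⊥)
open import Data.Vec.Base using (here; there)
open import Data.Bool using (Bool; true; false)
open import Data.Product using (Σ; _×_; _,_; proj₁; proj₂)
open import Relation.Nullary using (¬_)
open import Relation.Binary.Structures using (IsEquivalence)
open import Relation.Binary.PropositionalEquality using (_≡_; refl; sym; trans)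
import Relation.Binary.PropositionalEquality.Properties as ≡
import Relation.Binary.Construct.On as On
import Data.Empty as Empty

⊤E : ∀ {n} → EL n
⊤E = negE (andE (varE 0) (negE (varE 0)))

⊤E-true : ∀ {n} (M : Model n) (w : W M) → satEL M w ⊤E
⊤E-true M w (p , ¬p) = ¬p p

-- Everyone announcing K_i ⊤E: the silent announcement, which is always true.
silence : ∀ {n} → Fin n → EL n
silence _ = ⊤E

silent-true : ∀ {n} (M : Model n) (G : Subset n) (w : W M) → conjK M G silence w
silent-true M G w i _ v _ = ⊤E-true M v

empty-true : ∀ {n} (M : Model n) (ψ : Fin n → EL n) (w : W M) → conjK M ⊥ ψ w
empty-true M ψ w i i∈⊥ = Empty.⊥-elim (∉⊥ i∈⊥)

-- Factivity: what a member of G announces to know is true (reflexivity of ∼ᵢ).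
announced-fact : ∀ {n} (M : Model n) {G : Subset n} {χ : Fin n → EL n}
                 {i : Fin n} {w : W M} →
                 i ∈ G → conjK M G χ w → satEL M w (χ i)
announced-fact M {i = i} {w} i∈G known = known i i∈G w (IsEquivalence.refl (R-eq M i))

after : ∀ {n} (M : Model n) (G : Subset n) (ψ χ : Fin n → EL n) → Model n
after M G ψ χ = restrict M (λ v → conjK M G ψ v × conjK M (∁ G) χ v)

coal-intro : ∀ {n} (M : Model n) (w : W M) (G : Subset n) (φ : Form n) →
  ((ψ : Fin n → EL n) → Σ (Fin n → EL n) λ χ →
     (ψ-true : conjK M G ψ w) → Σ (conjK M (∁ G) χ w) λ χ-true →
       sat (after M G ψ χ) (w , (ψ-true , χ-true)) φ) →
  sat M w (coal G φ)
coal-intro {n} M w G φ answer ψ = χ , reach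
  where
  χ : Fin n → EL n
  χ = proj₁ (answer ψ)
  reach : conjK M G ψ w →
          ¬ ((h : conjK M G ψ w × conjK M (∁ G) χ w) → ¬ sat (after M G ψ χ) (w , h) φ)
  reach ψ-true refuted =
    let (χ-true , φ-after) = proj₂ (answer ψ) ψ-true
    in refuted (ψ-true , χ-true) φ-after

coal-neg⇒¬dcoal : ∀ {n} (M : Model n) (w : W M) (H : Subset n) (φ : Form n) →
                  sat M w (coal H (neg φ)) → sat M w (neg (dcoal H φ))
coal-neg⇒¬dcoal M w H φ forced ¬forced = ¬forced forced

refute-scheme : ∀ {n} (M : Model n) (w : W M) (G H : Subset n) (φ : Form n) →
                sat M w (coal (∁ (G ∪ H)) φ) → sat M w (coal G (neg (dcoal H φ))) →
                ¬ sat M w (scheme G H φ)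
refute-scheme M w G H φ antecedent blocked holds =
  holds (antecedent , λ consequent → consequent blocked)

a b : Fin 2
a = zero
b = suc zero

World : Set
World = Bool × Bool

observes : Fin 2 → World → Bool
observes zero       = proj₂
observes (suc zero) = proj₁

M₀ : Model 2
M₀ = record
  { W    = World
  ; R    = λ i u v → observes i u ≡ observes i v
  ; R-eq = λ i → On.isEquivalence (observes i) ≡.isEquivalence
  ; V    = valuation
  }
  where
  valuation : ℕ → World → Set
  valuation 0 u = proj₁ u ≡ true
  valuation 1 u = proj₂ u ≡ true
  valuation _ _ = Empty.⊥

w₀ : World
w₀ = true , true

G₀ H₀ : Subset 2
G₀ = ⁅ a ⁆
H₀ = ⁅ b ⁆

φ₀ : Form 2
φ₀ = and (K a (var 0)) (neg (K b (var 1)))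

tellP : Fin 2 → EL 2
tellP zero       = ⊤E
tellP (suc zero) = varE 0

tellP-true : ∀ u → proj₁ u ≡ true → conjK M₀ ⊤ tellP u
tellP-true u p-true zero       _ v _       = ⊤E-true M₀ v
tellP-true u p-true (suc zero) _ v same-p = trans (sym same-p) p-true

-- a announces K_a q (only a's component matters, as b ∉ ∁H₀).
tellQ : Fin 2 → EL 2
tellQ _ = varE 1

-- [⟨∅⟩]φ₀: after K_b p, agent a knows p but b cannot rule out (true , false).
antecedent : sat M₀ w₀ (coal (∁ (G₀ ∪ H₀)) φ₀)
antecedent = coal-intro M₀ w₀ ⊥ φ₀ λ ψ →
  tellP , λ ψ-true → tellP-true w₀ refl , φ₀-after ψ (ψ-true , tellP-true w₀ refl)
  where
  φ₀-after : ∀ ψ h → sat (after M₀ ⊥ ψ tellP) (w₀ , h) φ₀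
  φ₀-after ψ h = a-knows-p , b-unsure
    where
    a-knows-p : sat (after M₀ ⊥ ψ tellP) (w₀ , h) (K a (var 0))
    a-knows-p v _ = announced-fact M₀ {G = ⊤} {χ = tellP} (there here) (proj₂ (proj₂ v))
    b-unsure : ¬ sat (after M₀ ⊥ ψ tellP) (w₀ , h) (K b (var 1))
    b-unsure b-knows-q
      with b-knows-q ((true , false) , (empty-true M₀ ψ _ , tellP-true _ refl)) refl
    ... | ()

-- [⟨G₀⟩]¬⟨[H₀]⟩φ₀: b answers silently, then a answers K_a q, making K_b q true.
blocked : sat M₀ w₀ (coal G₀ (neg (dcoal H₀ φ₀)))
blocked = coal-intro M₀ w₀ G₀ (neg (dcoal H₀ φ₀)) λ ψ →
  silence , λ ψ-true →
    let h = (ψ-true , silent-true M₀ (∁ G₀) w₀)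
    in proj₂ h , coal-neg⇒¬dcoal (after M₀ G₀ ψ silence) (w₀ , h) H₀ φ₀ (a-answers ψ h)
  where
  a-answers : ∀ ψ h → sat (after M₀ G₀ ψ silence) (w₀ , h) (coal H₀ (neg φ₀))
  a-answers ψ h = coal-intro M₁ (w₀ , h) H₀ (neg φ₀) λ ψ′ →
    tellQ , λ ψ′-true → q-known , b-knows-q ψ′ (ψ′-true , q-known)
    where
    M₁ : Model 2
    M₁ = after M₀ G₀ ψ silence
    q-known : conjK M₁ (∁ H₀) tellQ (w₀ , h)
    q-known zero       _ v same-q = sym same-q
    q-known (suc zero) (there ())
    -- every world left satisfies q, so b knows q
    b-knows-q : ∀ ψ′ h′ → ¬ sat (after M₁ H₀ ψ′ tellQ) ((w₀ , h) , h′) φ₀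
    b-knows-q ψ′ h′ (_ , b-unsure) = b-unsure λ v _ →
      announced-fact M₁ {G = ∁ H₀} {χ = tellQ} {i = a} {w = proj₁ v} here (proj₂ (proj₂ v))

corollary1 : Σ ℕ λ n → Σ (Subset n) λ G → Σ (Subset n) λ H → Σ (Form n) λ φ →
    Σ (Model n) λ M → Σ (W M) λ w → ¬ sat M w (scheme G H φ)
corollary1 =
  2 , G₀ , H₀ , φ₀ , M₀ , w₀ , refute-scheme M₀ w₀ G₀ H₀ φ₀ antecedent blocked
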